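{- In the setting described in the context, suppose $N$ is an even square (recall $N\mid C$). Then $\theta\equiv(N-1)vu'\left(\frac{C}{Np}-A\right)\pmod 8$.
   Context: Setting: Let $N>1$ be an integer, $N=2^{\lambda(N)}N_1$ with $N_1$ odd. Let $D=c^2\Delta<0$ be a discriminant with fundamental part $\Delta$ and conductor $c$, $K=\mathbb Q(\sqrt D)$, $\mathcal O$ the order of discriminant $D$. Let $[A,B,C]$ be a primitive positive definite integral quadratic form with $B^2-4AC=D$, $\gcd(A,N)=1$ and $N\mid C$. Let $\alpha=\frac{ -B+\sqrt D}{2A}$, so $\mathcal O=\mathbb Z+\mathbb Z A\alpha$. Let $u,v\in\mathbb Z$ be such that $\pi=u+vA\alpha$ has norm $p=u^2-uvB+v^2AC$ a prime number not dividing $6cN$ that splits in $\mathcal O$, and assume $p\mid C$ and $p\mid u$. Set $u'=u-vB$. Let $v_1$, $A_1$ be the odd parts of $v$, $A$ ($v_1=1$ if $v=0$). Define the integer $\theta=(N-1)v\left(u'\frac{C}{Np}+A\left(\frac up(1-u'^2)-u'\right)\right)+3v_1A_1(N_1-1)(u'-1)+\frac{3\lambda(N)(u'^2-1)}{2}.$ -}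

module Defs where

open import Data.Nat using (ℕ)
open import Data.Integer using (ℤ; +_; _+_; _-_; _*_; -_; ∣_∣; _<_)
open import Data.Integer.DivMod using (_/_)
open import Data.Integer.Divisibility using (_∣_)
open import Data.Product using (_×_; ∃)
open import Data.Sum using (_⊎_)
open import Relation.Nullary using (¬_)
open import Relation.Binary.PropositionalEquality using (_≡_)
import Data.Nat as ℕ
import Data.Nat.Divisibility as ℕD

Odd : ℤ → Set
Odd x = ¬ ((+ 2) ∣ x)

infix 4 _≡_[mod_]
_≡_[mod_] : ℤ → ℤ → ℤ → Set
a ≡ b [mod m ] = m ∣ (a - b)

SquareFree : ℤ → Set
SquareFree x = ∀ (d : ℕ) → (d ℕ.* d) ℕD.∣ ∣ x ∣ → d ≡ 1

IsFundamentalDiscriminant : ℤ → Set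
IsFundamentalDiscriminant Δ =
  (Δ ≡ + 1 [mod + 4 ] × SquareFree Δ)
  ⊎ ∃ λ m → Δ ≡ (+ 4) * m × (m ≡ + 2 [mod + 4 ] ⊎ m ≡ + 3 [mod + 4 ]) × SquareFree m

IsOddPart : ℤ → ℤ → Set
IsOddPart x w = (x ≡ + 0 × w ≡ + 1)
              ⊎ (¬ (x ≡ + 0) × Odd w × ∃ λ (k : ℕ) → x ≡ (+ (2 ℕ.^ k)) * w)

-- the integer θ, with q₁ = C/(Np), q₂ = u/p, λN = λ(N), N₁ odd part of N,
-- v₁, A₁ odd parts of v, A, and u' = u - vB
θ : (N : ℕ) (A B C u v q₁ q₂ v₁ A₁ : ℤ) (λN N₁ : ℕ) → ℤ
θ N A B C u v q₁ q₂ v₁ A₁ λN N₁ =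
  let u' = u - v * B
      N' = + N
  in (N' - + 1) * v * (u' * q₁ + A * (q₂ * (+ 1 - u' * u') - u'))
     + (+ 3) * v₁ * A₁ * (+ N₁ - + 1) * (u' - + 1)
     + ((+ 3) * (+ λN) * (u' * u' - + 1)) / (+ 2)

-- p splits in the order O of discriminant D (used for odd primes p not dividing
-- the conductor): p is unramified (p ∤ D) and D is a square modulo p, i.e.
-- the Legendre symbol (D/p) = 1.
SplitsIn : ℤ → ℕ → Set
SplitsIn D p = ¬ ((+ p) ∣ D) × ∃ λ (x : ℤ) → (x * x ≡ D [mod + p ])

{-# OPTIONS --safe #-}
-- Since N = m² is even, the exponent λ(N) is even and N₁ is an odd square, so N₁ ≡ 1 (mod 8).
-- Writing p = u u' + v² A C with 2 ∣ N ∣ C shows that u' is odd, so u'² ≡ 1 (mod 8).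
-- Subtracting the right-hand side from θ leaves
--   − (N−1) v A (u/p) (u'² − 1) + 3 v₁ A₁ (N₁ − 1)(u' − 1) + 3 (λ(N)/2)(u'² − 1),
-- and each of these three terms is a multiple of 8.
module Submission where

open import Defs
open import Data.Nat using (ℕ; _^_)
open import Data.Nat.Coprimality using (Coprime)
open import Data.Nat.Primality using (Prime)
open import Data.Integer using (ℤ; +_; _+_; _-_; _*_; -_; ∣_∣; _<_)
open import Data.Integer.Divisibility using (_∣_)
open import Data.Product using (_×_; ∃)
open import Relation.Nullary using (¬_)
open import Relation.Binary.PropositionalEquality using (_≡_)
import Data.Nat as ℕ
import Data.Nat.Divisibility as ℕD

open import Data.Product using (_,_)
open import Data.Sum using (_⊎_; inj₁; inj₂)
open import Relation.Binary.PropositionalEquality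
  using (refl; sym; trans; cong; subst; module ≡-Reasoning)
import Data.Nat.Properties as ℕP
open import Relation.Nullary using (contradiction)
open import Data.Nat.Primality using (prime[2]; euclidsLemma; prime⇒irreducible)
open import Data.Integer.Properties using (+-identityˡ; +-comm; *-comm; *-cancelʳ-≡; pos-*)
open import Data.Integer.DivMod using (_/_; _%_; n%d<d; a≡a%n+[a/n]*n)
open import Data.Integer.Divisibility.Signed as Signed
  using (divides; ∣ᵤ⇒∣; ∣⇒∣ᵤ; ∣m∣n⇒∣m+n; ∣m⇒∣-m; ∣m⇒∣m*n; ∣n⇒∣m*n)
open import Data.Integer.Tactic.RingSolver using (solve-∀)
import Data.Nat.Tactic.RingSolver as ℕ-Solver
open import Data.List using (_∷_; [])

2∣prime⇒∣even : ∀ {p n} → Prime p → 2 ℕD.∣ n → 2 ℕD.∣ p → p ℕD.∣ n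
2∣prime⇒∣even p-prime 2∣n 2∣p with prime⇒irreducible p-prime 2∣p
... | inj₂ refl = 2∣n

2∣m*m⇒2∣m : ∀ {m} → 2 ℕD.∣ m ℕ.* m → 2 ℕD.∣ m
2∣m*m⇒2∣m {m} 2∣m*m with euclidsLemma m m prime[2] 2∣m*m
... | inj₁ 2∣m = 2∣m
... | inj₂ 2∣m = 2∣m

even-square : ∀ {m x} → m ℕ.* m ≡ 2 ℕ.* x → ∃ λ t → x ≡ 2 ℕ.* (t ℕ.* t)
even-square {m} {x} m*m≡2x with 2∣m*m⇒2∣m {m} (ℕD.divides x (trans m*m≡2x (ℕP.*-comm 2 x)))
... | ℕD.divides t refl = t , ℕP.*-cancelˡ-≡ x (2 ℕ.* (t ℕ.* t)) 2 (begin
  2 ℕ.* x                 ≡⟨ sym m*m≡2x ⟩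
  t ℕ.* 2 ℕ.* (t ℕ.* 2)   ≡⟨ ℕ-Solver.solve (t ∷ []) ⟩
  2 ℕ.* (2 ℕ.* (t ℕ.* t)) ∎)
  where open ≡-Reasoning

square≡2^l*odd : ∀ l {m n} → m ℕ.* m ≡ 2 ^ l ℕ.* n → ¬ 2 ℕD.∣ n →
                 (∃ λ j → l ≡ 2 ℕ.* j) × (∃ λ k → n ≡ k ℕ.* k)
square≡2^l*odd 0 {m} {n} m*m≡n _ =
  (0 , refl) , m , trans (sym (ℕP.*-identityˡ n)) (sym m*m≡n)
square≡2^l*odd 1 {m} {n} m*m≡2n n-odd
  with even-square {m} (trans m*m≡2n (ℕP.*-assoc 2 1 n))
... | t , n≡2t² =
  contradiction
    (ℕD.divides (t ℕ.* t) (trans (sym (ℕP.*-identityˡ n)) (trans n≡2t² (ℕP.*-comm 2 (t ℕ.* t)))))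
    n-odd
square≡2^l*odd (ℕ.suc (ℕ.suc l)) {m} {n} m*m≡4·2^l*n n-odd
  with even-square {m} (trans m*m≡4·2^l*n (ℕP.*-assoc 2 (2 ^ ℕ.suc l) n))
... | t , 2·2^l*n≡2t²
  with square≡2^l*odd l {t} {n}
         (ℕP.*-cancelˡ-≡ (t ℕ.* t) (2 ^ l ℕ.* n) 2
           (trans (sym 2·2^l*n≡2t²) (ℕP.*-assoc 2 (2 ^ l) n)))
         n-odd
... | (j , l≡2j) , n-square = (ℕ.suc j , trans (cong (2 ℕ.+_) l≡2j) (sym (ℕP.*-suc 2 j))) , n-square

¬2∣1 : ¬ (+ 2 Signed.∣ + 1)
¬2∣1 2∣1 with ℕD.∣1⇒≡1 (∣⇒∣ᵤ 2∣1)
... | ()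

even⊎odd : ∀ x → + 2 Signed.∣ x ⊎ ∃ λ k → x ≡ + 2 * k + + 1
even⊎odd x with x / + 2 | x % + 2 | n%d<d x (+ 2) | a≡a%n+[a/n]*n x (+ 2)
... | q | 0 | _ | x≡0+q*2 = inj₁ (divides q (trans x≡0+q*2 (+-identityˡ (q * + 2))))
... | q | 1 | _ | x≡1+q*2 =
  inj₂ (q , trans x≡1+q*2 (trans (+-comm (+ 1) (q * + 2)) (cong (_+ + 1) (*-comm q (+ 2)))))
... | _ | ℕ.suc (ℕ.suc _) | ℕ.s≤s (ℕ.s≤s ()) | _

odd⇒≡2k+1 : ∀ {x} → Odd x → ∃ λ k → x ≡ + 2 * k + + 1
odd⇒≡2k+1 {x} x-odd with even⊎odd x
... | inj₁ 2∣x = contradiction (∣⇒∣ᵤ 2∣x) x-odd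
... | inj₂ x≡2k+1 = x≡2k+1

2∣n*[n+1] : ∀ n → + 2 Signed.∣ n * (n + + 1)
2∣n*[n+1] n with even⊎odd n
... | inj₁ 2∣n = ∣m⇒∣m*n (n + + 1) 2∣n
... | inj₂ (k , refl) = ∣n⇒∣m*n n (divides (k + + 1) (2k+2≡[k+1]*2 k))
  where
  2k+2≡[k+1]*2 : ∀ k → + 2 * k + + 1 + + 1 ≡ (k + + 1) * + 2
  2k+2≡[k+1]*2 = solve-∀

odd²≡1[mod8] : ∀ {x} → Odd x → x * x ≡ + 1 [mod + 8 ]
odd²≡1[mod8] {x} x-odd with odd⇒≡2k+1 {x} x-odd
... | k , refl with 2∣n*[n+1] k
... | divides t k[k+1]≡2t = ∣⇒∣ᵤ (divides t (begin
  (+ 2 * k + + 1) * (+ 2 * k + + 1) - + 1 ≡⟨ [2k+1]²-1≡4k[k+1] k ⟩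
  + 4 * (k * (k + + 1))                   ≡⟨ cong (+ 4 *_) k[k+1]≡2t ⟩
  + 4 * (t * + 2)                         ≡⟨ 4[2t]≡8t t ⟩
  t * + 8                                 ∎))
  where
  open ≡-Reasoning
  [2k+1]²-1≡4k[k+1] : ∀ k → (+ 2 * k + + 1) * (+ 2 * k + + 1) - + 1 ≡ + 4 * (k * (k + + 1))
  [2k+1]²-1≡4k[k+1] = solve-∀
  4[2t]≡8t : ∀ t → + 4 * (t * + 2) ≡ t * + 8
  4[2t]≡8t = solve-∀

m*2/2≡m : ∀ m → m * + 2 / + 2 ≡ m
m*2/2≡m m
  with m * + 2 / + 2 | (m * + 2) % + 2 | n%d<d (m * + 2) (+ 2) | a≡a%n+[a/n]*n (m * + 2) (+ 2)
... | q | 0 | _ | 2m≡0+q*2 =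
  sym (*-cancelʳ-≡ m q (+ 2) (trans 2m≡0+q*2 (+-identityˡ (q * + 2))))
... | q | 1 | _ | 2m≡1+q*2 = contradiction (divides (m - q) (begin
  + 1                     ≡⟨ 1+2q-2q≡1 q ⟨
  + 1 + q * + 2 - q * + 2 ≡⟨ cong (_- q * + 2) (sym 2m≡1+q*2) ⟩
  m * + 2 - q * + 2       ≡⟨ 2m-2q≡2[m-q] m q ⟩
  (m - q) * + 2           ∎)) ¬2∣1
  where
  open ≡-Reasoning
  1+2q-2q≡1 : ∀ q → + 1 + q * + 2 - q * + 2 ≡ + 1
  1+2q-2q≡1 = solve-∀
  2m-2q≡2[m-q] : ∀ m q → m * + 2 - q * + 2 ≡ (m - q) * + 2
  2m-2q≡2[m-q] = solve-∀
... | _ | ℕ.suc (ℕ.suc _) | ℕ.s≤s (ℕ.s≤s ()) | _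

3[2j]x/2≡3jx : ∀ j x → + 3 * + (2 ℕ.* j) * x / + 2 ≡ + 3 * + j * x
3[2j]x/2≡3jx j x = begin
  + 3 * + (2 ℕ.* j) * x / + 2 ≡⟨ cong (λ i → + 3 * i * x / + 2) (pos-* 2 j) ⟩
  + 3 * (+ 2 * + j) * x / + 2 ≡⟨ cong (_/ + 2) (3[2j]x≡3jx*2 (+ j) x) ⟩
  + 3 * + j * x * + 2 / + 2   ≡⟨ m*2/2≡m (+ 3 * + j * x) ⟩
  + 3 * + j * x               ∎
  where
  open ≡-Reasoning
  3[2j]x≡3jx*2 : ∀ j x → + 3 * (+ 2 * j) * x ≡ + 3 * j * x * + 2
  3[2j]x≡3jx*2 = solve-∀

odd-norm⇒odd[u-vB] : ∀ {n} u v A B C → + n ≡ u * u - u * v * B + v * v * A * C →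
               + 2 ∣ C → Odd (+ n) → Odd (u - v * B)
odd-norm⇒odd[u-vB] {n} u v A B C n≡norm 2∣C n-odd 2∣u-vB =
  n-odd (∣⇒∣ᵤ (subst (+ 2 Signed.∣_) (sym n≡u[u-vB]+v²AC)
    (∣m∣n⇒∣m+n (∣n⇒∣m*n u (∣ᵤ⇒∣ 2∣u-vB)) (∣n⇒∣m*n (v * v * A) (∣ᵤ⇒∣ 2∣C)))))
  where
  norm≡u[u-vB]+v²AC : ∀ u v A B C →
    u * u - u * v * B + v * v * A * C ≡ u * (u - v * B) + v * v * A * C
  norm≡u[u-vB]+v²AC = solve-∀
  n≡u[u-vB]+v²AC : + n ≡ u * (u - v * B) + v * v * A * C
  n≡u[u-vB]+v²AC = trans n≡norm (norm≡u[u-vB]+v²AC u v A B C)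

θ-difference : ∀ N A B C u v q₁ q₂ v₁ A₁ λN N₁ →
  let u' = u - v * B in
  θ N A B C u v q₁ q₂ v₁ A₁ λN N₁ - (+ N - + 1) * v * u' * (q₁ - A)
  ≡ - ((+ N - + 1) * v * A * q₂ * (u' * u' - + 1))
    + + 3 * v₁ * A₁ * (+ N₁ - + 1) * (u' - + 1)
    + + 3 * + λN * (u' * u' - + 1) / + 2
θ-difference N A B C u v q₁ q₂ v₁ A₁ λN N₁ =
  polynomial-identity (+ N) v u' q₁ A q₂ v₁ A₁ (+ N₁) (+ 3 * + λN * (u' * u' - + 1) / + 2)
  where
  u' : ℤ
  u' = u - v * B
  polynomial-identity : ∀ N v U q₁ A q₂ v₁ A₁ N₁ T →
    (N - + 1) * v * (U * q₁ + A * (q₂ * (+ 1 - U * U) - U))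
      + + 3 * v₁ * A₁ * (N₁ - + 1) * (U - + 1) + T - (N - + 1) * v * U * (q₁ - A)
    ≡ - ((N - + 1) * v * A * q₂ * (U * U - + 1)) + + 3 * v₁ * A₁ * (N₁ - + 1) * (U - + 1) + T
  polynomial-identity = solve-∀

mainTheorem11 : (N : ℕ) (λN N₁ : ℕ) (c : ℕ) (Δ D A B C u v : ℤ) (p : ℕ)
    (q₁ q₂ v₁ A₁ : ℤ) →
    1 ℕ.< N → N ≡ 2 ^ λN ℕ.* N₁ → ¬ (2 ℕD.∣ N₁) →
    1 ℕ.≤ c → IsFundamentalDiscriminant Δ →
    D ≡ (+ (c ℕ.* c)) * Δ → D < + 0 →
    B * B - (+ 4) * A * C ≡ D → + 0 < A →
    (∀ (d : ℤ) → d ∣ A → d ∣ B → d ∣ C → ∣ d ∣ ≡ 1) →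
    Coprime ∣ A ∣ N → (+ N) ∣ C →
    Prime p → + p ≡ u * u - u * v * B + v * v * A * C →
    ¬ (p ℕD.∣ 6 ℕ.* c ℕ.* N) →
    SplitsIn D p →
    (+ p) ∣ C → (+ p) ∣ u →
    C ≡ (+ N) * (+ p) * q₁ → u ≡ (+ p) * q₂ →
    IsOddPart v v₁ → IsOddPart A A₁ →
    (∃ λ (m : ℕ) → N ≡ m ℕ.* m) → 2 ℕD.∣ N →
    θ N A B C u v q₁ q₂ v₁ A₁ λN N₁
    ≡ (+ N - + 1) * v * (u - v * B) * (q₁ - A) [mod + 8 ]
mainTheorem11 N λN N₁ c Δ D A B C u v p q₁ q₂ v₁ A₁ _ N≡2^λN*N₁ N₁-odd _ _ _ _ _ _ _ _ N∣C
              p-prime p≡norm p∤6cN _ _ _ _ _ _ _ (m , N≡m*m) 2∣N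
  with square≡2^l*odd λN {m} {N₁} (trans (sym N≡m*m) N≡2^λN*N₁) N₁-odd
... | (j , refl) , (k , refl) =
  ∣⇒∣ᵤ (subst (+ 8 Signed.∣_) (sym (θ-difference N A B C u v q₁ q₂ v₁ A₁ (2 ℕ.* j) (k ℕ.* k)))
    (∣m∣n⇒∣m+n (∣m∣n⇒∣m+n 8∣first 8∣second) 8∣third))
  where
  u' : ℤ
  u' = u - v * B
  p-odd : Odd (+ p)
  p-odd 2∣p = p∤6cN (2∣prime⇒∣even p-prime (ℕD.∣m⇒∣m*n N (ℕD.∣m⇒∣m*n c (ℕD.divides 3 refl))) 2∣p)
  8∣u'²-1 : + 8 Signed.∣ u' * u' - + 1
  8∣u'²-1 = ∣ᵤ⇒∣ (odd²≡1[mod8] {u'} (odd-norm⇒odd[u-vB] u v A B C p≡norm (ℕD.∣-trans 2∣N N∣C) p-odd))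
  k-odd : Odd (+ k)
  k-odd 2∣k = N₁-odd (ℕD.∣m⇒∣m*n {d = 2} {m = k} k 2∣k)
  8∣N₁-1 : + 8 Signed.∣ + (k ℕ.* k) - + 1
  8∣N₁-1 = subst (λ x → + 8 Signed.∣ x - + 1) (sym (pos-* k k)) (∣ᵤ⇒∣ (odd²≡1[mod8] {+ k} k-odd))
  8∣first : + 8 Signed.∣ - ((+ N - + 1) * v * A * q₂ * (u' * u' - + 1))
  8∣first = ∣m⇒∣-m (∣n⇒∣m*n ((+ N - + 1) * v * A * q₂) 8∣u'²-1)
  8∣second : + 8 Signed.∣ + 3 * v₁ * A₁ * (+ (k ℕ.* k) - + 1) * (u' - + 1)
  8∣second = ∣m⇒∣m*n (u' - + 1) (∣n⇒∣m*n (+ 3 * v₁ * A₁) 8∣N₁-1)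
  8∣third : + 8 Signed.∣ + 3 * + (2 ℕ.* j) * (u' * u' - + 1) / + 2
  8∣third = subst (+ 8 Signed.∣_) (sym (3[2j]x/2≡3jx j (u' * u' - + 1))) (∣n⇒∣m*n (+ 3 * + j) 8∣u'²-1)
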